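{- (1) A quasi-ordering $(X,\preceq)$ is a better quasi-ordering if and only if the set system $\mathrm{ss}((X,\preceq))$ is a better elastic set system. (2) Every better elastic set system is a finitely elastic set system.
   Context: A set system over $T$ is a family $\mathcal{L}\subseteq P(T)$. $\mathrm{ss}((X,\preceq))$ is the set of upper-closed subsets $A\subseteq X$ ($x\in A$, $x\preceq y$ imply $y\in A$). $\mathrm{qo}(\mathcal{L})$ is the quasi-ordering on $\bigcup\mathcal{L}$ with $x\preceq_{\mathcal{L}}y$ iff every $L\in\mathcal{L}$ containing $x$ contains $y$. $\mathcal{L}$ is a better elastic set system (BESS) if $\mathrm{qo}(\mathcal{L})$ is a better quasi-ordering (BQO), where: a barrier is a family $B$ of finite subsets of $\omega$ (identified with increasing sequences) with $\bigcup B$ infinite, such that every infinite $\sigma\subseteq\bigcup B$ has a member of $B$ as a prefix of its increasing enumeration, and no member of $B$ is a proper subset of another; $s\triangleleft t$ means $s$ is a prefix of $u=s\cup t$ and $t$ a prefix of $u\setminus\{\min u\}$; $\mathrm{o.t.}(B)$ is the lexicographic order type of $B$; $(Q,\preceq)$ is an $\alpha$-wqo if for every barrier $B$ with $\mathrm{o.t.}(B)\le\alpha$ and every $f:B\to Q$ there are $s\triangleleft t$ with $f(s)\preceq f(t)$; BQO means $\alpha$-wqo for all countable $\alpha$. A learning sequence of $\mathcal{L}$ is a sequence $\langle\langle t_0,A_1\rangle,\langle t_1,A_2\rangle,\ldots\rangle$ with $A_{i+1}\in\mathcal{L}$, $\{t_0,\ldots,t_i\}\subseteq A_{i+1}$;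 it is bad if $t_{i+1}\notin A_{i+1}$ for all $i$; $\mathcal{L}$ is a finitely elastic set system (FESS) if it has no infinite bad learning sequence. -}

module Defs where

open import Level using (Level; _⊔_) renaming (suc to lsuc; zero to lzero)
open import Data.Nat using (ℕ; _<_; _≤_; suc)
open import Data.List using (List; []; _∷_; _++_; map; upTo; drop)
open import Data.List.Membership.Propositional using (_∈_; _∉_)
open import Data.List.Relation.Unary.Linked using (Linked)
open import Data.Product using (Σ; ∃; _×_; _,_; Σ-syntax; ∃-syntax)
open import Relation.Binary.PropositionalEquality using (_≡_)
open import Data.Sum using (_⊎_)
open import Relation.Nullary using (¬_)
open import Function.Bundles using (_⇔_)

-- Finite subsets of ω, identified with their increasing enumerations.

Increasing : List ℕ → Set
Increasing = Linked _<_

Prefix : List ℕ → List ℕ → Set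
Prefix s u = ∃[ w ] (s ++ w ≡ u)

ProperSubset : List ℕ → List ℕ → Set
ProperSubset s t = (∀ n → n ∈ s → n ∈ t) × (∃[ n ] (n ∈ t × n ∉ s))

IsUnion : List ℕ → List ℕ → List ℕ → Set
IsUnion s t u = Increasing u × (∀ n → (n ∈ u → n ∈ s ⊎ n ∈ t) × (n ∈ s ⊎ n ∈ t → n ∈ u))

-- s ◁ t : with u = s ∪ t, s is a prefix of u and t is a prefix of u ∖ {min u}
-- (for increasing u, the enumeration of u ∖ {min u} is drop 1 u)
_◁_ : List ℕ → List ℕ → Set
s ◁ t = Σ[ u ∈ List ℕ ] (IsUnion s t u × Prefix s u × Prefix t (drop 1 u))

InUnion : ℕ → (List ℕ → Set) → Set
InUnion n B = ∃[ s ] (B s × n ∈ s)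

initSeg : (ℕ → ℕ) → ℕ → List ℕ
initSeg σ k = map σ (upTo k)

record Barrier (B : List ℕ → Set) : Set where
  field
    members-increasing : ∀ s → B s → Increasing s
    union-infinite     : ∀ n → ∃[ m ] (n ≤ m × InUnion m B)
    covers             : (σ : ℕ → ℕ) → (∀ i → σ i < σ (suc i)) →
                         (∀ i → InUnion (σ i) B) → ∃[ k ] B (initSeg σ k)
    antichain          : ∀ s t → B s → B t → ¬ ProperSubset s t

-- Better quasi-orderings (α-wqo for all countable α; every barrier has
-- countable order type, so this is: good for every barrier).

BQO : ∀ {a r} {Q : Set a} → (Q → Q → Set r) → Set (a ⊔ r ⊔ lsuc lzero)
BQO {Q = Q} _≼_ =
  (B : List ℕ → Set) → Barrier B → (f : (s : List ℕ) → B s → Q) →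
  ∃[ s ] ∃[ t ] Σ[ bs ∈ B s ] Σ[ bt ∈ B t ] (s ◁ t × f s bs ≼ f t bt)

SetSystem : Set → Set₁
SetSystem T = (T → Set) → Set

⋃ : {T : Set} → SetSystem T → Set₁
⋃ {T} L = Σ[ x ∈ T ] Σ[ A ∈ (T → Set) ] (L A × A x)

qo : {T : Set} (L : SetSystem T) → ⋃ L → ⋃ L → Set₁
qo {T} L (x , _) (y , _) = (A : T → Set) → L A → A x → A y

ss : {X : Set} → (X → X → Set) → SetSystem X
ss {X} _≼_ A = ∀ x y → x ≼ y → A x → A y

BESS : {T : Set} → SetSystem T → Set₁
BESS L = BQO (qo L)

-- Learning sequences: t i = t_i, A i = A_{i+1}.

IsLearningSequence : {T : Set} → SetSystem T → (ℕ → T) → (ℕ → (T → Set)) → Set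
IsLearningSequence L t A = ∀ i → L (A i) × (∀ j → j ≤ i → A i (t j))

IsBad : {T : Set} → (ℕ → T) → (ℕ → (T → Set)) → Set
IsBad t A = ∀ i → ¬ A i (t (suc i))

FESS : {T : Set} → SetSystem T → Set₁
FESS {T} L = ¬ (Σ[ t ∈ (ℕ → T) ] Σ[ A ∈ (ℕ → (T → Set)) ]
                  (IsLearningSequence L t A × IsBad t A))

-- (1) The maps x ↦ (x, ↑x) : X → ⋃ ss(X) and (x, _) ↦ x : ⋃ ss(X) → X both reflect the
-- order (upsets are upward closed, and x ∈ ↑x), and BQO is pulled back along
-- order-reflecting maps.  (2) On the barrier of singletons, {i} ◁ {j} means i < j, so a
-- BQO is in particular a wqo.  Applied to the points (t_n, A_{n+1}) of ⋃ L it yields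
-- i < j with t_i ⪯ t_j; as t_i ∈ A_j, also t_j ∈ A_j, contradicting badness.
module Submission where

open import Defs
open import Data.Product using (_×_)
open import Function.Bundles using (_⇔_)
open import Relation.Binary.PropositionalEquality using (_≡_)
open import Relation.Binary.Structures using (IsPreorder)

open import Data.Nat using (ℕ; suc; _<_; s≤s)
open import Data.Nat.Properties using (≤-refl)
open import Data.List using (List; []; _∷_)
open import Data.List.Relation.Unary.Any using (here)
open import Data.List.Relation.Unary.Linked using (Linked; _∷_)
open import Data.Product using (∃-syntax; _,_; proj₁; proj₂)
open import Relation.Binary.PropositionalEquality using (refl)
open import Function.Bundles using (mk⇔)
open import Relation.Nullary using (¬_)

BQO-reflect : ∀ {a b r s} {Q : Set a} {R : Set b}
              (_≼_ : Q → Q → Set r) (_⊑_ : R → R → Set s) (h : Q → R) →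
              (∀ {x y} → h x ⊑ h y → x ≼ y) → BQO _⊑_ → BQO _≼_
BQO-reflect _ _ h reflect bqo B barrier f
  with bqo B barrier (λ u bu → h (f u bu))
... | u , v , bu , bv , u◁v , fu⊑fv = u , v , bu , bv , u◁v , reflect fu⊑fv

Singleton : List ℕ → Set
Singleton s = ∃[ n ] (s ≡ n ∷ [])

singleton-barrier : Barrier Singleton
singleton-barrier = record
  { members-increasing = λ { _ (_ , refl) → Linked.[-] }
  ; union-infinite     = λ n → n , ≤-refl , (n ∷ [] , (n , refl) , here refl)
  ; covers             = λ σ _ _ → 1 , (σ 0 , refl)
  ; antichain          = not-proper
  }
  where
  not-proper : ∀ s t → Singleton s → Singleton t → ¬ ProperSubset s t
  not-proper _ _ (m , refl) (n , refl) (m∈t⇒ , k , here refl , k∉s)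
    with m∈t⇒ m (here refl)
  ... | here refl = k∉s (here refl)

◁-singleton⇒< : ∀ {i j} → (i ∷ []) ◁ (j ∷ []) → i < j
◁-singleton⇒< (_ , (i<j ∷ _ , _) , (_ , refl) , (_ , refl)) = i<j

BQO⇒good : ∀ {a r} {Q : Set a} {_≼_ : Q → Q → Set r} → BQO _≼_ →
           (q : ℕ → Q) → ∃[ i ] ∃[ j ] (i < j × q i ≼ q j)
BQO⇒good bqo q with bqo Singleton singleton-barrier (λ { _ (n , _) → q n })
... | _ , _ , (i , refl) , (j , refl) , i◁j , qi≼qj = i , j , ◁-singleton⇒< i◁j , qi≼qj

module _ {X : Set} {_≼_ : X → X → Set} (preorder : IsPreorder _≡_ _≼_) where
  open IsPreorder preorder using (trans) renaming (refl to ≼-refl)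

  ↑ : X → X → Set
  ↑ x y = x ≼ y

  ↑-upperClosed : ∀ x → ss _≼_ (↑ x)
  ↑-upperClosed x _ _ y≼z x≼y = trans x≼y y≼z

  principal : X → ⋃ (ss _≼_)
  principal x = x , ↑ x , ↑-upperClosed x , ≼-refl

  BQO⇔BESS-ss : BQO _≼_ ⇔ BESS (ss _≼_)
  BQO⇔BESS-ss = mk⇔
    (BQO-reflect (qo (ss _≼_)) _≼_ (λ (x , _) → x) λ x≼y A upA Ax → upA _ _ x≼y Ax)
    (BQO-reflect _≼_ (qo (ss _≼_)) principal
      λ {x} ↑x⊑↑y → ↑x⊑↑y (↑ x) (↑-upperClosed x) ≼-refl)

BESS⇒FESS : {T : Set} (L : SetSystem T) → BESS L → FESS L
BESS⇒FESS L bess (t , A , learning , bad)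
  with BQO⇒good {_≼_ = qo L} bess (λ n → t n , A n , learning n .proj₁ , learning n .proj₂ n ≤-refl)
... | i , suc k , s≤s i≤k , tᵢ⊑tⱼ =
  bad k (tᵢ⊑tⱼ (A k) (learning k .proj₁) (learning k .proj₂ i i≤k))

lemma4 : ((X : Set) (_≼_ : X → X → Set) → IsPreorder _≡_ _≼_ →
            (BQO _≼_ ⇔ BESS (ss _≼_)))
         × ((T : Set) (L : SetSystem T) → BESS L → FESS L)
lemma4 = (λ _ _ → BQO⇔BESS-ss) , (λ _ → BESS⇒FESS)
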